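{- $\mathsf{WF}_{b4}^s \implies \mathsf{CSB}^*$.
   Context: Work in $\mathsf{ZF}$. For sets $X,Y$: $|X|=|Y|$ means there is a bijection $X\to Y$; $|X|\leq^*|Y|$ means $X=\emptyset$ or $Y$ surjects onto $X$; $|X|=^*|Y|$ means $|X|\leq^*|Y|$ and $|Y|\leq^*|X|$. $\mathsf{WF}_{b4}^s$ is the statement: given an infinite sequence of sets $(A_i)$ and a corresponding sequence of surjections $f_i : A_i \to A_{i+1}$, there is some $n \in \mathbb{N}$ such that $|A_n| = |A_{n+1}|$. $\mathsf{CSB}^*$ (Dual Cantor–Schröder–Bernstein) is the statement: if $|X| =^* |Y|$ then $|X| = |Y|$. -}

module Defs where

open import Level using (Level)
open import Data.Nat using (ℕ; suc)
open import Data.Product using (Σ; Σ-syntax)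
open import Data.Sum using (_⊎_)
open import Relation.Nullary using (¬_)
open import Relation.Binary.PropositionalEquality using (_≡_)
open import Function.Bundles using (_⤖_)

-- Propositional (mere) existence, rendered as double negation so that
-- "there is a surjection/bijection" does not hand out a choice function.
∥_∥ : ∀ {a} → Set a → Set a
∥ A ∥ = ¬ ¬ A

IsSurjection : ∀ {a b} {A : Set a} {B : Set b} → (A → B) → Set (a Level.⊔ b)
IsSurjection {A = A} {B = B} f = (y : B) → ∥ Σ[ x ∈ A ] f x ≡ y ∥

_≈c_ : ∀ {ℓ} → Set ℓ → Set ℓ → Set ℓ
X ≈c Y = ∥ X ⤖ Y ∥

_≤*_ : ∀ {ℓ} → Set ℓ → Set ℓ → Set ℓ
X ≤* Y = ∥ (¬ X) ⊎ (Σ[ g ∈ (Y → X) ] IsSurjection g) ∥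

_=*_ : ∀ {ℓ} → Set ℓ → Set ℓ → Set ℓ
X =* Y = ∥ (X ≤* Y) Data.Product.× (Y ≤* X) ∥

WF-b4-s : (ℓ : Level) → Set (Level.suc ℓ)
WF-b4-s ℓ = (A : ℕ → Set ℓ) (f : (i : ℕ) → A i → A (suc i)) →
            ((i : ℕ) → IsSurjection (f i)) →
            ∥ Σ[ n ∈ ℕ ] (A n ≈c A (suc n)) ∥

CSB* : (ℓ : Level) → Set (Level.suc ℓ)
CSB* ℓ = (X Y : Set ℓ) → X =* Y → X ≈c Y

module Submission where

open import Defs
open import Level using (Level)
open import Data.Nat using (ℕ; zero; suc)
open import Data.Product using (Σ; _,_; proj₁; _×_)
open import Data.Sum using (_⊎_; inj₁; inj₂; [_,_])
open import Data.Empty using (⊥-elim)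
open import Effect.Monad using (RawMonad)
open import Function using (const; _∘_)
open import Relation.Nullary using (¬_)
open import Relation.Nullary.Negation using (¬¬-Monad)
open import Function.Bundles using (_⤖_; mk⤖)
open import Function.Construct.Symmetry using (⤖-sym)

-- If X and Y surject onto each other, the sequence X ↠ Y ↠ X ↠ Y ↠ ⋯ has every
-- pair of consecutive terms equal to (X , Y) or (Y , X), so WF^s_{b4} yields a
-- bijection between X and Y.  The other cases of ≤* force both sets to be empty.

private
  variable
    ℓ : Level
    X Y : Set ℓ

¬-codomain-of-surjection : ¬ X → (f : X → Y) → IsSurjection f → ¬ Y
¬-codomain-of-surjection ¬X f f-surj y = f-surj y (¬X ∘ proj₁)

¬⇒⤖ : ¬ X → ¬ Y → X ⤖ Y
¬⇒⤖ ¬X ¬Y = mk⤖ {to = λ x → ⊥-elim (¬X x)} ((λ {x} _ → ⊥-elim (¬X x)) , λ y → ⊥-elim (¬Y y))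

≤*-empty : (¬ Y) ⊎ Σ (X → Y) IsSurjection → ¬ X → ¬ Y
≤*-empty = [ const , (λ (f , f-surj) ¬X → ¬-codomain-of-surjection ¬X f f-surj) ]

=*⇒empty⊎mutually-surjective :
  X =* Y → ∥ (¬ X × ¬ Y) ⊎ (Σ (X → Y) IsSurjection × Σ (Y → X) IsSurjection) ∥
=*⇒empty⊎mutually-surjective {X = X} {Y = Y} X=*Y = do
  (X≤*Y , Y≤*X) ← X=*Y
  ¬X⊎Y↠X ← X≤*Y
  ¬Y⊎X↠Y ← Y≤*X
  pure (cases ¬X⊎Y↠X ¬Y⊎X↠Y)
  where
  open RawMonad ¬¬-Monad
  cases : (¬ X) ⊎ Σ (Y → X) IsSurjection → (¬ Y) ⊎ Σ (X → Y) IsSurjection →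
          (¬ X × ¬ Y) ⊎ (Σ (X → Y) IsSurjection × Σ (Y → X) IsSurjection)
  cases (inj₁ ¬X) ¬Y⊎X↠Y = inj₁ (¬X , ≤*-empty ¬Y⊎X↠Y ¬X)
  cases ¬X⊎Y↠X (inj₁ ¬Y) = inj₁ (≤*-empty ¬X⊎Y↠X ¬Y , ¬Y)
  cases (inj₂ Y↠X) (inj₂ X↠Y) = inj₂ (X↠Y , Y↠X)

module Alternating {ℓ : Level} {X Y : Set ℓ} (f : X → Y) (g : Y → X) where

  Alt : ℕ → Set ℓ
  Alt zero          = X
  Alt (suc zero)    = Y
  Alt (suc (suc n)) = Alt n

  alt : (n : ℕ) → Alt n → Alt (suc n)
  alt zero          = f
  alt (suc zero)    = g
  alt (suc (suc n)) = alt n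

  alt-surjective : IsSurjection f → IsSurjection g → (n : ℕ) → IsSurjection (alt n)
  alt-surjective f-surj g-surj zero          = f-surj
  alt-surjective f-surj g-surj (suc zero)    = g-surj
  alt-surjective f-surj g-surj (suc (suc n)) = alt-surjective f-surj g-surj n

  Alt-step⇒⤖ : (n : ℕ) → Alt n ⤖ Alt (suc n) → X ⤖ Y
  Alt-step⇒⤖ zero          e = e
  Alt-step⇒⤖ (suc zero)    e = ⤖-sym e
  Alt-step⇒⤖ (suc (suc n)) e = Alt-step⇒⤖ n e

theorem8p1 : ∀ {ℓ : Level} → WF-b4-s ℓ → CSB* ℓ
theorem8p1 wf X Y X=*Y = do
  inj₂ ((f , f-surj) , (g , g-surj)) ← =*⇒empty⊎mutually-surjective X=*Y
    where inj₁ (¬X , ¬Y) → pure (¬⇒⤖ ¬X ¬Y)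
  let open Alternating f g
  (n , Altₙ≈Altₙ₊₁) ← wf Alt alt (alt-surjective f-surj g-surj)
  Altₙ⤖Altₙ₊₁ ← Altₙ≈Altₙ₊₁
  pure (Alt-step⇒⤖ n Altₙ⤖Altₙ₊₁)
  where open RawMonad ¬¬-Monad
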